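{- The lifting functor $\mathcal L$ is left adjoint to the forgetful functor $U$ from the category of subsingleton complete posets with a least element to the category of sets. Explicitly, let $X$ be a set, let $D$ be a subsingleton complete poset with a least element, and let $f:X\to U(D)$ be a function. Then there is a unique morphism $\widetilde f:\mathcal L(X)\to D$ of that category such that $\widetilde f(\eta_X(x))=f(x)$ for all $x:X$. Here $\mathcal L(X)$ carries the order $\sqsubseteq$.
   Context: The ambient theory is intensional Martin-Löf type theory with function extensionality, propositional extensionality and propositional truncation. $\Omega$ denotes the type of propositions in the universe $\mathcal U_0$. The lifting of a type $X$ is $\mathcal L(X):=\sum_{P:\Omega}(P\to X)$, with $\mathrm{isdefined}$ the first projection. For a set $X$ it is ordered by $l\sqsubseteq m:=(\mathrm{isdefined}(l)\to l=m)$. The unit is $\eta_X(x):=(\mathbf 1,\lambda t.x)$. A poset is a set with a proposition-valued reflexive, antisymmetric, transitive relation. A poset is subsingleton complete if every family indexed by a proposition has a least upper bound. The category of subsingleton complete posets with a least element has as morphisms the monotone maps preserving least upper bounds of proposition-indexed families. -}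

module Defs where

open import Level using (Level; _⊔_; 0ℓ; Setω) renaming (suc to lsuc)
open import Data.Unit using (⊤; tt)
open import Data.Product using (Σ; _×_; _,_; proj₁; proj₂)
open import Function using (_∘_)
open import Relation.Binary.PropositionalEquality using (_≡_; refl)
open import Axiom.Extensionality.Propositional using (Extensionality)

isProp : ∀ {a} → Set a → Set a
isProp A = (x y : A) → x ≡ y

isSet : ∀ {a} → Set a → Set a
isSet A = (x y : A) → isProp (x ≡ y)

FunExt : Setω
FunExt = ∀ {a b} → Extensionality a b

PropExt : Set₁
PropExt = (P Q : Set) → isProp P → isProp Q → (P → Q) → (Q → P) → P ≡ Q

Ω : Set₁
Ω = Σ Set isProp

⊤-isProp : isProp ⊤
⊤-isProp tt tt = refl

𝓛 : ∀ {x} → Set x → Set (lsuc 0ℓ ⊔ x)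
𝓛 X = Σ Ω (λ P → proj₁ P → X)

isdefined : ∀ {x} {X : Set x} → 𝓛 X → Set
isdefined l = proj₁ (proj₁ l)

_⊑_ : ∀ {x} {X : Set x} → 𝓛 X → 𝓛 X → Set (lsuc 0ℓ ⊔ x)
l ⊑ m = isdefined l → l ≡ m

η : ∀ {x} {X : Set x} → X → 𝓛 X
η x = ((⊤ , ⊤-isProp) , λ _ → x)

IsLub : ∀ {d e} {D : Set d} (_≤_ : D → D → Set e) {I : Set} → (I → D) → D → Set (d ⊔ e)
IsLub _≤_ α s = ((i : _) → α i ≤ s) × ((u : _) → ((i : _) → α i ≤ u) → s ≤ u)

record SSCPoset (d e : Level) : Set (lsuc (d ⊔ e)) where
  field
    Carrier     : Set d
    _≤_         : Carrier → Carrier → Set e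
    Carrier-set : isSet Carrier
    ≤-prop      : (x y : Carrier) → isProp (x ≤ y)
    ≤-refl      : (x : Carrier) → x ≤ x
    ≤-antisym   : (x y : Carrier) → x ≤ y → y ≤ x → x ≡ y
    ≤-trans     : (x y z : Carrier) → x ≤ y → y ≤ z → x ≤ z
    ss-complete : (P : Set) → isProp P → (α : P → Carrier) → Σ Carrier (IsLub _≤_ α)
    ⊥           : Carrier
    ⊥-least     : (x : Carrier) → ⊥ ≤ x

IsMorphism : ∀ {a b d e} {A : Set a} {D : Set d}
             (_⊑A_ : A → A → Set b) (_≤D_ : D → D → Set e) → (A → D) → Set (lsuc 0ℓ ⊔ a ⊔ b ⊔ d ⊔ e)
IsMorphism {A = A} _⊑A_ _≤D_ g =
  ((l m : A) → l ⊑A m → g l ≤D g m) ×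
  ((P : Set) → isProp P → (α : P → A) (s : A) → IsLub _⊑A_ α s → IsLub _≤D_ (g ∘ α) (g s))

Hom𝓛 : ∀ {x d e} (X : Set x) (D : SSCPoset d e) → Set (lsuc 0ℓ ⊔ x ⊔ d ⊔ e)
Hom𝓛 X D = Σ (𝓛 X → SSCPoset.Carrier D) (IsMorphism (_⊑_ {X = X}) (SSCPoset._≤_ D))

module Submission where

open import Defs
open import Data.Product using (Σ; _,_; proj₁; proj₂; ∃!)
open import Relation.Binary.PropositionalEquality using (_≡_; refl; sym; trans; cong; subst)
open import Axiom.UniquenessOfIdentityProofs using (module Constant⇒UIP)
open import Data.Unit using (⊤; tt)
open import Function using (_∘_)

-- The extension is f̃ l = ⋁ { f x | x is the value of l }, a supremum indexed by the
-- proposition isdefined l.  It is unique because every l is the supremum in 𝓛 X of the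
-- family η ∘ value l indexed by isdefined l, and morphisms preserve such suprema.  Lub
-- preservation of f̃ rests on the fact that if a supremum s of α : P → 𝓛 X is defined, then
-- some α p is defined: the partial element defined exactly when some α p is, is an upper
-- bound of α, hence above s.

isProp⇒isSet : ∀ {a} {A : Set a} → isProp A → isSet A
isProp⇒isSet pr x y = Constant⇒UIP.≡-irrelevant (λ {x} {y} _ → pr x y) (λ _ _ → refl)

Σ-isProp : ∀ {a b} {A : Set a} {B : A → Set b} →
           isProp A → ((x : A) → isProp (B x)) → isProp (Σ A B)
Σ-isProp pA pB (x , u) (x′ , v) with pA x x′
... | refl = cong (x ,_) (pB x u v)

module _ (fe : FunExt) where

  Π-isProp : ∀ {a b} {A : Set a} {B : A → Set b} →
             ((x : A) → isProp (B x)) → isProp ((x : A) → B x)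
  Π-isProp pB g h = fe λ x → pB x (g x) (h x)

  isProp-isProp : ∀ {a} {A : Set a} → isProp (isProp A)
  isProp-isProp p q = fe λ x → fe λ y → isProp⇒isSet p x y (p x y) (q x y)

  Σ-≡-prop : ∀ {a b} {A : Set a} {B : A → Set b} → ((x : A) → isProp (B x)) →
             {u v : Σ A B} → proj₁ u ≡ proj₁ v → u ≡ v
  Σ-≡-prop pB {x , b} {.x , c} refl = cong (x ,_) (pB x b c)

  IsLub-isProp : ∀ {d e} {D : Set d} {_≤_ : D → D → Set e} → ((a b : D) → isProp (a ≤ b)) →
                 {I : Set} (α : I → D) (s : D) → isProp (IsLub _≤_ α s)
  IsLub-isProp ≤-prop α s =
    Σ-isProp (Π-isProp λ i → ≤-prop (α i) s)
             λ _ → Π-isProp λ u → Π-isProp λ _ → ≤-prop s u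

  IsMorphism-isProp : ∀ {a b d e} {A : Set a} {D : Set d}
                      {_⊑A_ : A → A → Set b} {_≤D_ : D → D → Set e} →
                      ((x y : D) → isProp (x ≤D y)) →
                      (g : A → D) → isProp (IsMorphism _⊑A_ _≤D_ g)
  IsMorphism-isProp ≤-prop g =
    Σ-isProp (Π-isProp λ l → Π-isProp λ m → Π-isProp λ _ → ≤-prop (g l) (g m))
             λ _ → Π-isProp λ P → Π-isProp λ _ → Π-isProp λ α → Π-isProp λ s → Π-isProp λ _ →
               IsLub-isProp ≤-prop (g ∘ α) (g s)

  IsLub-cong : ∀ {d e} {D : Set d} {_≤_ : D → D → Set e} {I : Set} {α β : I → D} {s : D} →
               ((i : I) → α i ≡ β i) → IsLub _≤_ α s → IsLub _≤_ β s
  IsLub-cong {_≤_ = _≤_} {s = s} α≗β = subst (λ γ → IsLub _≤_ γ s) (fe α≗β)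

module Lifting (fe : FunExt) (pe : PropExt) {x} {X : Set x} where

  value : (l : 𝓛 X) → isdefined l → X
  value = proj₂

  isdefined-isProp : (l : 𝓛 X) → isProp (isdefined l)
  isdefined-isProp l = proj₂ (proj₁ l)

  𝓛-≡ : (l m : 𝓛 X) → (isdefined l → isdefined m) → (isdefined m → isdefined l) →
        ((i : isdefined l) (j : isdefined m) → value l i ≡ value m j) → l ≡ m
  𝓛-≡ ((P , pP) , φ) ((Q , pQ) , ψ) l→m m→l agree with pe P Q pP pQ l→m m→l
  ... | refl with isProp-isProp fe pP pQ
  ... | refl = cong ((P , pP) ,_) (fe λ i → agree i i)

  defined⇒≡η : (l : 𝓛 X) (i : isdefined l) → l ≡ η (value l i)
  defined⇒≡η l i = 𝓛-≡ l (η (value l i)) (λ _ → tt) (λ _ → i)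
                       λ j _ → cong (value l) (isdefined-isProp l j i)

  η-value-isLub : (l : 𝓛 X) → IsLub _⊑_ (η ∘ value l) l
  η-value-isLub l = (λ i _ → sym (defined⇒≡η l i))
                  , λ u ηv⊑u i → trans (defined⇒≡η l i) (ηv⊑u i tt)

  ⨆ : (P : Set) → isProp P → (P → 𝓛 X) → 𝓛 X
  ⨆ P pP α = (Σ P (isdefined ∘ α) , Σ-isProp pP (isdefined-isProp ∘ α))
           , λ { (p , i) → value (α p) i }

  ⨆-upper : (P : Set) (pP : isProp P) (α : P → 𝓛 X) (p : P) → α p ⊑ ⨆ P pP α
  ⨆-upper P pP α p i = trans (defined⇒≡η (α p) i) (sym (defined⇒≡η (⨆ P pP α) (p , i)))

  isdefined-lub : (P : Set) → isProp P → (α : P → 𝓛 X) (s : 𝓛 X) →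
                  IsLub _⊑_ α s → isdefined s → Σ P (isdefined ∘ α)
  isdefined-lub P pP α s (_ , least) j =
    subst isdefined (least (⨆ P pP α) (⨆-upper P pP α) j) j

module Suprema {d e} (D : SSCPoset d e) where
  open SSCPoset D

  lub-unique : {P : Set} {α : P → Carrier} {s t : Carrier} →
               IsLub _≤_ α s → IsLub _≤_ α t → s ≡ t
  lub-unique (s-upper , s-least) (t-upper , t-least) =
    ≤-antisym _ _ (s-least _ t-upper) (t-least _ s-upper)

  const-isLub : (a : Carrier) → IsLub _≤_ (λ (_ : ⊤) → a) a
  const-isLub a = (λ _ → ≤-refl a) , λ u a≤u → a≤u tt

  ⋁ : (P : Set) → isProp P → (P → Carrier) → Carrier
  ⋁ P pP α = proj₁ (ss-complete P pP α)

  ⋁-isLub : (P : Set) (pP : isProp P) (α : P → Carrier) → IsLub _≤_ α (⋁ P pP α)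
  ⋁-isLub P pP α = proj₂ (ss-complete P pP α)

module _ (fe : FunExt) (pe : PropExt) {x d e} {X : Set x} (D : SSCPoset d e) where
  open SSCPoset D
  open Lifting fe pe
  open Suprema D

  morphisms-≡-on-η : (g h : 𝓛 X → Carrier) →
                     IsMorphism _⊑_ _≤_ g → IsMorphism _⊑_ _≤_ h →
                     ((y : X) → g (η y) ≡ h (η y)) → (l : 𝓛 X) → g l ≡ h l
  morphisms-≡-on-η g h (_ , g-lub) (_ , h-lub) g∘η≗h∘η l =
    lub-unique (IsLub-cong fe {_≤_ = _≤_} (g∘η≗h∘η ∘ value l) (lubOf g g-lub)) (lubOf h h-lub)
    where
    lubOf : (k : 𝓛 X → Carrier) →
            ((P : Set) → isProp P → (α : P → 𝓛 X) (s : 𝓛 X) →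
             IsLub _⊑_ α s → IsLub _≤_ (k ∘ α) (k s)) →
            IsLub _≤_ (k ∘ η ∘ value l) (k l)
    lubOf k k-lub = k-lub (isdefined l) (isdefined-isProp l) (η ∘ value l) l (η-value-isLub l)

  module Extension (f : X → Carrier) where

    f̃ : 𝓛 X → Carrier
    f̃ l = ⋁ (isdefined l) (isdefined-isProp l) (f ∘ value l)

    f̃-least : (l : 𝓛 X) (u : Carrier) → ((i : isdefined l) → f (value l i) ≤ u) → f̃ l ≤ u
    f̃-least l = proj₂ (⋁-isLub (isdefined l) (isdefined-isProp l) (f ∘ value l))

    f̃-η : (y : X) → f̃ (η y) ≡ f y
    f̃-η y = lub-unique (⋁-isLub ⊤ ⊤-isProp (λ _ → f y)) (const-isLub (f y))

    f̃-defined : (l : 𝓛 X) (i : isdefined l) → f (value l i) ≡ f̃ l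
    f̃-defined l i = trans (sym (f̃-η (value l i))) (cong f̃ (sym (defined⇒≡η l i)))

    f̃-monotone : (l m : 𝓛 X) → l ⊑ m → f̃ l ≤ f̃ m
    f̃-monotone l m l⊑m = f̃-least l (f̃ m) λ i →
      subst (f (value l i) ≤_) (trans (f̃-defined l i) (cong f̃ (l⊑m i))) (≤-refl _)

    f̃-preserves-lubs : (P : Set) → isProp P → (α : P → 𝓛 X) (s : 𝓛 X) →
                       IsLub _⊑_ α s → IsLub _≤_ (f̃ ∘ α) (f̃ s)
    f̃-preserves-lubs P pP α s s-lub@(s-upper , _) =
      (λ p → f̃-monotone (α p) s (s-upper p)) , least
      where
      least : (u : Carrier) → ((p : P) → f̃ (α p) ≤ u) → f̃ s ≤ u
      least u f̃α≤u = f̃-least s u λ j → below (isdefined-lub P pP α s s-lub j) j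
        where
        below : Σ P (isdefined ∘ α) → (j : isdefined s) → f (value s j) ≤ u
        below (p , i) j =
          subst (_≤ u) (trans (cong f̃ (s-upper p i)) (sym (f̃-defined s j))) (f̃α≤u p)

    f̃-isMorphism : IsMorphism _⊑_ _≤_ f̃
    f̃-isMorphism = f̃-monotone , f̃-preserves-lubs

-- X need not be a set: nothing here uses that ⊑ is proposition-valued.
theorem4p16 : FunExt → PropExt →
    ∀ {x d e} (X : Set x) → isSet X → (D : SSCPoset d e) → (f : X → SSCPoset.Carrier D) →
      ∃! _≡_ (λ (g : Hom𝓛 X D) → (y : X) → proj₁ g (η y) ≡ f y)
theorem4p16 fe pe X _ D f =
    (f̃ , f̃-isMorphism)
  , f̃-η
  , λ { {g , g-mor} g∘η≗f →
        Σ-≡-prop fe (IsMorphism-isProp fe (SSCPoset.≤-prop D))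
          (fe (morphisms-≡-on-η fe pe D f̃ g f̃-isMorphism g-mor
                 λ y → trans (f̃-η y) (sym (g∘η≗f y)))) }
  where open Extension fe pe D f
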